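{- Let $p>3$ be a prime. Define \[\alpha(p) = \sum_{r=1}^{p-1} \frac{3r\,(3p+1)!!!}{2(3r+4)} \in \mathbb{Q}.\] Then $\alpha(p)$ has denominator prime to $p$ and $\alpha(p) \equiv 2 \pmod p$, i.e. $\alpha(p) = 2$ in $\mathbb{F}_p$.
   Context: The triple factorial $n!!!$ for integers $n \geq 0$ is defined by $0!!! = 1!!! = 2!!! = 1$ and $n!!! = n \cdot (n-3)!!!$ for $n \geq 3$. -}

module Defs where

open import Data.Nat using (ℕ; zero; suc; _+_; _*_; _∸_)
open import Data.Integer using (ℤ; +_)
open import Data.Rational using (ℚ; _/_; 0ℚ) renaming (_+_ to _+ℚ_)
open import Data.List using (List; foldr; map; upTo)

_!!! : ℕ → ℕ
zero !!! = 1
suc zero !!! = 1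
suc (suc zero) !!! = 1
suc (suc (suc n)) !!! = suc (suc (suc n)) * (n !!!)

sumℚ : List ℚ → ℚ
sumℚ = foldr _+ℚ_ 0ℚ

term : ℕ → ℕ → ℚ
term p r = (+ (3 * r * ((3 * p + 1) !!!))) / (2 * (4 + 3 * r))

α : ℕ → ℚ
α p = sumℚ (map (λ i → term p (suc i)) (upTo (p ∸ 1)))

-- Since 4 = 3·1 + 1 and 3r + 4 = 3(r + 1) + 1 are distinct factors of (3p + 1)!!! = ∏_{k ≤ p} (3k + 1),
-- every summand is an integer. Modulo p the map k ↦ 3k + 1 is a bijection, so exactly one k₀ < p has
-- p ∣ 3k₀ + 1, and k₀ ∉ {0, 1}. For r + 1 ≠ k₀ the summand vanishes mod p, because p divides
-- (3p + 1)!!! but not 2(3r + 4). For r₀ = k₀ - 1, cancelling 3r₀ + 4 = 3k₀ + 1 leaves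
-- 2·summand = 3r₀ (3p + 1) W, where W is the product of the nonzero values 3k + 1 with k < p. These
-- are the units mod p, each once; pairing every unit with its inverse (Wilson) gives W ≡ -1, and
-- with 3p + 1 ≡ 1 and 3r₀ ≡ -4 this reads 2·summand ≡ 4.

module Submission where

open import Data.Empty using (⊥-elim)
open import Data.Integer as ℤ using (+_)
import Data.Integer.Properties as ℤ
open import Data.Integer.Divisibility as ℤ using ()
import Data.Integer.Tactic.RingSolver as ℤ-Solver
open import Data.List using (List; []; _∷_; _++_; length; map; applyDownFrom; upTo)
open import Data.List.Membership.Propositional using (_∈_)
open import Data.List.Membership.Propositional.Properties using (∈-∃++; ∈-applyDownFrom⁺; ∈-upTo⁺; ∈-upTo⁻)
open import Data.List.Properties using (map-cong-local)
open import Data.List.Relation.Binary.Permutation.Propositional using (_↭_; ↭⇒↭ₛ; prep; ↭-sym)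
open import Data.List.Relation.Binary.Permutation.Propositional.Properties
  using (shift; ∈-resp-↭; All-resp-↭; ↭-length)
  renaming (map⁺ to ↭-map⁺)
import Data.List.Relation.Binary.Permutation.Setoid.Properties as SetoidPermutation
open import Data.List.Relation.Unary.All as All using (All; []; _∷_)
open import Data.List.Relation.Unary.AllPairs as AllPairs using (AllPairs; []; _∷_)
open import Data.List.Relation.Unary.AllPairs.Properties using (applyDownFrom⁺₁)
open import Data.List.Relation.Unary.Any using (here; there)
open import Data.List.Relation.Unary.Unique.Propositional using (Unique)
open import Data.List.Relation.Unary.Unique.Propositional.Properties using () renaming (upTo⁺ to upTo-unique)
open import Data.Nat
open import Data.Nat.Coprimality using (prime⇒coprime; coprime-Bézout; 1-coprimeTo)
import Data.Nat.Coprimality as Coprime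
open import Data.Nat.Divisibility
  using ( _∣_; divides; m%n≡0⇒n∣m; n∣m⇒m%n≡0; ∣1⇒≡1; ∣-refl; ∣-trans; n∣m*n; *-monoʳ-∣; *-monoˡ-∣
        ; module ∣-Reasoning)
open import Data.Nat.DivMod
open import Data.Nat.GCD using (module Bézout)
open import Data.Nat.ListAction using (sum; product)
open import Data.Nat.ListAction.Properties using (sum-↭; product-↭)
open import Data.Nat.Primality
  using (Prime; prime⇒nonZero; prime⇒nonTrivial; prime⇒¬composite; composite[4]; euclidsLemma)
open import Data.Nat.Properties
open import Data.Nat.Tactic.RingSolver using (solve-∀)
open import Data.Product using (∃-syntax; _×_; _,_)
open import Data.Rational as ℚ using (mkℚ; ↥_; ↧_)
open import Data.Rational.Properties using (normalize-coprime; fromℚᵘ-cong; /-cong)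
open import Data.Rational.Unnormalised using (mkℚᵘ; *≡*)
open import Data.Sum using (_⊎_; inj₁; inj₂; [_,_]′; fromInj₁) renaming (map to ⊎-map)
open import Function using (_∘′_)
open import Level using (Level; 0ℓ)
open import Relation.Binary.Bundles using (Setoid)
open import Relation.Binary.Core using (Rel)
open import Relation.Binary.Definitions using (Symmetric; _Respects_)
open import Relation.Binary.PropositionalEquality as ≡ using (_≡_; _≢_; refl; cong; cong₂; ≢-sym)
import Relation.Binary.Reasoning.Setoid as SetoidReasoning
open import Relation.Binary.Structures using (IsEquivalence)
open import Relation.Nullary using (¬_)

open import Defs

private variable
  a ℓ : Level
  A : Set a

∈⇒↭∷ : ∀ {x : A} {xs} → x ∈ xs → ∃[ ys ] xs ↭ x ∷ ys
∈⇒↭∷ x∈xs with ys , zs , refl ← ∈-∃++ x∈xs = ys ++ zs , shift _ ys zs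

AllPairs-resp-↭ : {R : Rel A ℓ} → Symmetric R → (AllPairs R) Respects _↭_
AllPairs-resp-↭ {R = R} sym σ =
  SetoidPermutation.AllPairs-resp-↭ (≡.setoid _) sym (≡.resp₂ R) (↭⇒↭ₛ σ)

module Modular (n : ℕ) .{{_ : NonZero n}} where

  infix 4 _≈_ _≉_

  -- A record rather than a bare equation, so that both sides are inferable.
  record _≈_ (a b : ℕ) : Set where
    constructor mod≡
    field residue : a % n ≡ b % n

  _≉_ : ℕ → ℕ → Set
  a ≉ b = ¬ a ≈ b

  ≈-isEquivalence : IsEquivalence _≈_
  ≈-isEquivalence = record
    { refl  = mod≡ refl
    ; sym   = λ (mod≡ e) → mod≡ (≡.sym e)
    ; trans = λ (mod≡ e) (mod≡ f) → mod≡ (≡.trans e f)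
    }

  ≈-setoid : Setoid 0ℓ 0ℓ
  ≈-setoid = record { isEquivalence = ≈-isEquivalence }

  open IsEquivalence ≈-isEquivalence public
    using () renaming (refl to ≈-refl; sym to ≈-sym; trans to ≈-trans)

  module ≈-Reasoning = SetoidReasoning ≈-setoid

  ≉-sym : ∀ {a b} → a ≉ b → b ≉ a
  ≉-sym a≉b b≈a = a≉b (≈-sym b≈a)

  ≡⇒≈ : ∀ {a b} → a ≡ b → a ≈ b
  ≡⇒≈ e = mod≡ (cong (_% n) e)

  %-≈ : ∀ a → a % n ≈ a
  %-≈ a = mod≡ (m%n%n≡m%n a n)

  ≈⇒≡ : ∀ {a b} → a < n → b < n → a ≈ b → a ≡ b
  ≈⇒≡ a<n b<n (mod≡ e) = ≡.trans (≡.sym (m<n⇒m%n≡m a<n)) (≡.trans e (m<n⇒m%n≡m b<n))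

  ≈⇒≡+kn : ∀ {a b} → b < n → a ≈ b → ∃[ k ] a ≡ b + k * n
  ≈⇒≡+kn {a} b<n (mod≡ e) =
    a / n , ≡.trans (m≡m%n+[m/n]*n a n) (cong (_+ a / n * n) (≡.trans e (m<n⇒m%n≡m b<n)))

  positive<n⇒≉0 : ∀ {a} → 0 < a → a < n → a ≉ 0
  positive<n⇒≉0 0<a a<n a≈0 = <-irrefl (≡.sym (≈⇒≡ a<n (>-nonZero⁻¹ n) a≈0)) 0<a

  +-cong : ∀ {a b c d} → a ≈ b → c ≈ d → a + c ≈ b + d
  +-cong {a} {b} {c} {d} (mod≡ e) (mod≡ f) = mod≡ (begin
    (a + c) % n             ≡⟨ %-distribˡ-+ a c n ⟩
    (a % n + c % n) % n     ≡⟨ cong₂ (λ x y → (x + y) % n) e f ⟩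
    (b % n + d % n) % n     ≡⟨ %-distribˡ-+ b d n ⟨
    (b + d) % n             ∎)
    where open ≡.≡-Reasoning

  *-cong : ∀ {a b c d} → a ≈ b → c ≈ d → a * c ≈ b * d
  *-cong {a} {b} {c} {d} (mod≡ e) (mod≡ f) = mod≡ (begin
    (a * c) % n             ≡⟨ %-distribˡ-* a c n ⟩
    (a % n * (c % n)) % n   ≡⟨ cong₂ (λ x y → (x * y) % n) e f ⟩
    (b % n * (d % n)) % n   ≡⟨ %-distribˡ-* b d n ⟨
    (b * d) % n             ∎)
    where open ≡.≡-Reasoning

  +-congʳ : ∀ c {a b} → a ≈ b → a + c ≈ b + c
  +-congʳ c e = +-cong e (≈-refl {c})

  *-congˡ : ∀ a {b c} → b ≈ c → a * b ≈ a * c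
  *-congˡ a = *-cong (≈-refl {a})

  *-congʳ : ∀ c {a b} → a ≈ b → a * c ≈ b * c
  *-congʳ c e = *-cong e (≈-refl {c})

  *≈0 : ∀ a {b} → b ≈ 0 → a * b ≈ 0
  *≈0 a b≈0 = ≈-trans (*-congˡ a b≈0) (≡⇒≈ (*-zeroʳ a))

  m+kn≈m : ∀ m k → m + k * n ≈ m
  m+kn≈m m k = mod≡ ([m+kn]%n≡m%n m k n)

  m*n≈0 : ∀ m → m * n ≈ 0
  m*n≈0 m = ≈-trans (≡⇒≈ (≡.sym (+-identityˡ (m * n)))) (m+kn≈m 0 m)

  -1# : ℕ
  -1# = n ∸ 1

  1+-1#≡n : 1 + -1# ≡ n
  1+-1#≡n = m+[n∸m]≡n (>-nonZero⁻¹ n)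

  n≈0 : n ≈ 0
  n≈0 = ≈-trans (≡⇒≈ (≡.sym (*-identityˡ n))) (m*n≈0 1)

  1+-1#≈0 : 1 + -1# ≈ 0
  1+-1#≈0 = ≈-trans (≡⇒≈ 1+-1#≡n) n≈0

  +-cancelʳ : ∀ {a b} c → a + c ≈ b + c → a ≈ b
  +-cancelʳ {a} {b} c e = begin
    a                      ≈⟨ m+kn≈m a c ⟨
    a + c * n              ≡⟨ regroup a ⟩
    (a + c) + c * -1#      ≈⟨ +-congʳ (c * -1#) e ⟩
    (b + c) + c * -1#      ≡⟨ regroup b ⟨
    b + c * n              ≈⟨ m+kn≈m b c ⟩
    b                      ∎
    where
    open ≈-Reasoning
    distrib : ∀ x c m → x + c * (1 + m) ≡ (x + c) + c * m
    distrib = solve-∀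
    regroup : ∀ x → x + c * n ≡ (x + c) + c * -1#
    regroup x = ≡.trans (cong (λ m → x + c * m) (≡.sym 1+-1#≡n)) (distrib x c -1#)

  x+y≈0⇒x≈y*-1# : ∀ {x y} → x + y ≈ 0 → x ≈ y * -1#
  x+y≈0⇒x≈y*-1# {x} {y} x+y≈0 = +-cancelʳ y (begin
    x + y                ≈⟨ x+y≈0 ⟩
    0                    ≈⟨ m*n≈0 y ⟨
    y * n                ≡⟨ cong (y *_) 1+-1#≡n ⟨
    y * (1 + -1#)        ≡⟨ expand y -1# ⟩
    y * -1# + y          ∎)
    where
    open ≈-Reasoning
    expand : ∀ y m → y * (1 + m) ≡ y * m + y
    expand = solve-∀

  -1#*-1#≈1 : -1# * -1# ≈ 1
  -1#*-1#≈1 = ≈-sym (x+y≈0⇒x≈y*-1# 1+-1#≈0)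

  sum-≈0 : ∀ (f : ℕ → ℕ) {xs} → All (λ x → f x ≈ 0) xs → sum (map f xs) ≈ 0
  sum-≈0 f []             = ≈-refl
  sum-≈0 f (fx≈0 ∷ fxs≈0) = +-cong fx≈0 (sum-≈0 f fxs≈0)

  sum-≈-single : ∀ (f : ℕ → ℕ) {xs i₀} → Unique xs → i₀ ∈ xs →
                 (∀ {i} → i ∈ xs → i ≢ i₀ → f i ≈ 0) → sum (map f xs) ≈ f i₀
  sum-≈-single f {xs} {i₀} unique i₀∈xs others≈0 with ys , σ ← ∈⇒↭∷ i₀∈xs = begin
    sum (map f xs)           ≡⟨ sum-↭ (↭-map⁺ f σ) ⟩
    f i₀ + sum (map f ys)    ≈⟨ +-cong ≈-refl (sum-≈0 f (All.tabulate ys≈0)) ⟩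
    f i₀ + 0                 ≡⟨ +-identityʳ (f i₀) ⟩
    f i₀                     ∎
    where
    open ≈-Reasoning
    ys≈0 : ∀ {i} → i ∈ ys → f i ≈ 0
    ys≈0 i∈ys = others≈0 (∈-resp-↭ (↭-sym σ) (there i∈ys))
      (≢-sym (All.lookup (AllPairs.head (AllPairs-resp-↭ ≢-sym σ unique)) i∈ys))

module PrimeModulus {p : ℕ} (p-prime : Prime p) where

  instance
    p≢0 : NonZero p
    p≢0 = prime⇒nonZero p-prime

  open Modular p public

  ≈0⇒∣ : ∀ {a} → a ≈ 0 → p ∣ a
  ≈0⇒∣ {a} (mod≡ e) = m%n≡0⇒n∣m a p (≡.trans e (m<n⇒m%n≡m (>-nonZero⁻¹ p)))

  ∣⇒≈0 : ∀ {a} → p ∣ a → a ≈ 0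
  ∣⇒≈0 {a} p∣a = mod≡ (≡.trans (n∣m⇒m%n≡0 a p p∣a) (≡.sym (m<n⇒m%n≡m (>-nonZero⁻¹ p))))

  *≈0⇒≈0⊎≈0 : ∀ {a b} → a * b ≈ 0 → a ≈ 0 ⊎ b ≈ 0
  *≈0⇒≈0⊎≈0 {a} {b} ab≈0 = ⊎-map ∣⇒≈0 ∣⇒≈0 (euclidsLemma a b p-prime (≈0⇒∣ ab≈0))

  1≉0 : 1 ≉ 0
  1≉0 1≈0 = nonTrivial⇒≢1 {{prime⇒nonTrivial p-prime}} (∣1⇒≡1 (≈0⇒∣ 1≈0))

  -1#≉0 : -1# ≉ 0
  -1#≉0 -1#≈0 = 1≉0 (≈-trans (+-cong (≈-refl {1}) (≈-sym -1#≈0)) 1+-1#≈0)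

  inverse : ∀ {a} → a ≉ 0 → ∃[ b ] a * b ≈ 1
  inverse {a} a≉0 with coprime-Bézout (prime⇒coprime p-prime {{r≢0}} (m%n<n a p))
    where
    r≢0 : NonZero (a % p)
    r≢0 = ≢-nonZero (λ r≡0 → a≉0 (∣⇒≈0 (m%n≡0⇒n∣m a p r≡0)))
  ... | Bézout.-+ x y eq = y , (begin
    a * y           ≈⟨ *-congʳ y (%-≈ a) ⟨
    a % p * y       ≡⟨ *-comm (a % p) y ⟩
    y * (a % p)     ≡⟨ eq ⟨
    1 + x * p       ≈⟨ m+kn≈m 1 x ⟩
    1               ∎)
    where open ≈-Reasoning
  ... | Bézout.+- x y eq = y * -1# , (begin
    a * (y * -1#)        ≈⟨ *-congʳ (y * -1#) (%-≈ a) ⟨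
    a % p * (y * -1#)    ≡⟨ *-assoc (a % p) y -1# ⟨
    a % p * y * -1#      ≡⟨ cong (_* -1#) (*-comm (a % p) y) ⟩
    y * (a % p) * -1#    ≈⟨ x+y≈0⇒x≈y*-1# (≈-trans (≡⇒≈ eq) (m*n≈0 x)) ⟨
    1                    ∎)
    where open ≈-Reasoning

  *-cancelˡ : ∀ {c a b} → c ≉ 0 → c * a ≈ c * b → a ≈ b
  *-cancelˡ {c} {a} {b} c≉0 ca≈cb with d , cd≈1 ← inverse c≉0 = begin
    a              ≡⟨ *-identityˡ a ⟨
    1 * a          ≈⟨ *-congʳ a dc≈1 ⟨
    d * c * a      ≡⟨ *-assoc d c a ⟩
    d * (c * a)    ≈⟨ *-congˡ d ca≈cb ⟩
    d * (c * b)    ≡⟨ *-assoc d c b ⟨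
    d * c * b      ≈⟨ *-congʳ b dc≈1 ⟩
    1 * b          ≡⟨ *-identityˡ b ⟩
    b              ∎
    where
    open ≈-Reasoning
    dc≈1 : d * c ≈ 1
    dc≈1 = ≈-trans (≡⇒≈ (*-comm d c)) cd≈1

  inverse-unique : ∀ {x y z} → x * z ≈ 1 → y * z ≈ 1 → x ≈ y
  inverse-unique {x} {y} {z} xz≈1 yz≈1 = *-cancelˡ z≉0 (begin
    z * x   ≡⟨ *-comm z x ⟩
    x * z   ≈⟨ xz≈1 ⟩
    1       ≈⟨ yz≈1 ⟨
    y * z   ≡⟨ *-comm y z ⟩
    z * y   ∎)
    where
    open ≈-Reasoning
    z≉0 : z ≉ 0
    z≉0 z≈0 = 1≉0 (≈-trans (≈-sym yz≈1) (*≈0 y z≈0))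

  x*x≈1⇒x≈±1 : ∀ {x} → x * x ≈ 1 → x ≈ 1 ⊎ x ≈ -1#
  x*x≈1⇒x≈±1 {x} x²≈1 =
    [ inj₂ ∘′ x+1≈0⇒x≈-1# , inj₁ ∘′ x+-1#≈0⇒x≈1 ]′ (*≈0⇒≈0⊎≈0 product≈0)
    where
    open ≈-Reasoning
    expand : ∀ x m → (x + 1) * (x + m) ≡ x * x + x * (1 + m) + m
    expand = solve-∀
    product≈0 : (x + 1) * (x + -1#) ≈ 0
    product≈0 = begin
      (x + 1) * (x + -1#)            ≡⟨ expand x -1# ⟩
      x * x + x * (1 + -1#) + -1#    ≡⟨ cong (λ m → x * x + x * m + -1#) 1+-1#≡n ⟩
      x * x + x * p + -1#            ≈⟨ +-congʳ -1# (+-cong x²≈1 (m*n≈0 x)) ⟩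
      1 + 0 + -1#                    ≈⟨ 1+-1#≈0 ⟩
      0                              ∎
    x+1≈0⇒x≈-1# : x + 1 ≈ 0 → x ≈ -1#
    x+1≈0⇒x≈-1# x+1≈0 = ≈-trans (x+y≈0⇒x≈y*-1# x+1≈0) (≡⇒≈ (*-identityˡ -1#))
    x+-1#≈0⇒x≈1 : x + -1# ≈ 0 → x ≈ 1
    x+-1#≈0⇒x≈1 x+-1#≈0 = ≈-trans (x+y≈0⇒x≈y*-1# x+-1#≈0) -1#*-1#≈1

  InverseClosed : List ℕ → Set
  InverseClosed xs = ∀ {x} → x ∈ xs → ∃[ y ] y ∈ xs × x * y ≈ 1

  InverseClosed-resp-↭ : InverseClosed Respects _↭_
  InverseClosed-resp-↭ σ closed x∈ys =
    let y , y∈xs , xy≈1 = closed (∈-resp-↭ (↭-sym σ) x∈ys) in y , ∈-resp-↭ σ y∈xs , xy≈1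

  drop-self-inverse : ∀ {x ys} → AllPairs _≉_ (x ∷ ys) → InverseClosed (x ∷ ys) → x * x ≈ 1 →
                      InverseClosed ys
  drop-self-inverse (x≉ys ∷ _) closed xx≈1 z∈ys with closed (there z∈ys)
  ... | _ , here refl , zx≈1   = ⊥-elim (All.lookup x≉ys z∈ys (inverse-unique xx≈1 zx≈1))
  ... | w , there w∈ys , zw≈1  = w , w∈ys , zw≈1

  drop-inverse-pair : ∀ {x y zs} → AllPairs _≉_ (x ∷ y ∷ zs) → InverseClosed (x ∷ y ∷ zs) →
                      x * y ≈ 1 → InverseClosed zs
  drop-inverse-pair {x} {y} ((_ ∷ x≉zs) ∷ y≉zs ∷ _) closed xy≈1 z∈zs with closed (there (there z∈zs))
  ... | _ , here refl , zx≈1          = ⊥-elim (All.lookup y≉zs z∈zs (inverse-unique yx≈1 zx≈1))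
    where
    yx≈1 : y * x ≈ 1
    yx≈1 = ≈-trans (≡⇒≈ (*-comm y x)) xy≈1
  ... | _ , there (here refl) , zy≈1  = ⊥-elim (All.lookup x≉zs z∈zs (inverse-unique xy≈1 zy≈1))
  ... | w , there (there w∈zs) , zw≈1 = w , w∈zs , zw≈1

  -- Pair every element with its inverse; only ±1 are self-inverse, and -1 is excluded.
  product-inverseClosed≈1 : ∀ xs → AllPairs _≉_ xs → InverseClosed xs → All (_≉ -1#) xs →
                            product xs ≈ 1
  product-inverseClosed≈1 xs = go (length xs) xs ≤-refl
    where
    go : ∀ k xs → length xs ≤ k → AllPairs _≉_ xs → InverseClosed xs → All (_≉ -1#) xs →
         product xs ≈ 1
    go _ [] _ _ _ _ = ≈-refl
    go (suc k) (x ∷ ys) (s≤s |ys|≤k) distinct closed (x≉-1 ∷ ys≉-1) with closed (here refl)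
    ... | _ , here refl , xx≈1 = begin
      x * product ys   ≈⟨ *-congʳ (product ys) x≈1 ⟩
      1 * product ys   ≡⟨ *-identityˡ (product ys) ⟩
      product ys       ≈⟨ go k ys |ys|≤k (AllPairs.tail distinct) closed-ys ys≉-1 ⟩
      1                ∎
      where
      open ≈-Reasoning
      x≈1 : x ≈ 1
      x≈1 = fromInj₁ (⊥-elim ∘′ x≉-1) (x*x≈1⇒x≈±1 xx≈1)
      closed-ys : InverseClosed ys
      closed-ys = drop-self-inverse distinct closed xx≈1
    ... | y , there y∈ys , xy≈1 with zs , σ ← ∈⇒↭∷ y∈ys = begin
      x * product ys         ≡⟨ cong (x *_) (product-↭ σ) ⟩
      x * (y * product zs)   ≡⟨ *-assoc x y (product zs) ⟨
      x * y * product zs     ≈⟨ *-congʳ (product zs) xy≈1 ⟩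
      1 * product zs         ≡⟨ *-identityˡ (product zs) ⟩
      product zs             ≈⟨ go k zs |zs|≤k distinct-zs closed-zs zs≉-1 ⟩
      1                      ∎
      where
      open ≈-Reasoning
      distinct′ : AllPairs _≉_ (x ∷ y ∷ zs)
      distinct′ = AllPairs-resp-↭ ≉-sym (prep x σ) distinct
      distinct-zs : AllPairs _≉_ zs
      distinct-zs = AllPairs.tail (AllPairs.tail distinct′)
      closed-zs : InverseClosed zs
      closed-zs = drop-inverse-pair distinct′ (InverseClosed-resp-↭ (prep x σ) closed) xy≈1
      zs≉-1 : All (_≉ -1#) zs
      zs≉-1 = All.tail (All-resp-↭ σ ys≉-1)
      |zs|≤k : length zs ≤ k
      |zs|≤k = ≤-trans (n≤1+n _) (≤-trans (≤-reflexive (≡.sym (↭-length σ))) |ys|≤k)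

  product-inverseClosed≈-1 : ∀ {x xs} → AllPairs _≉_ xs → InverseClosed xs → x ∈ xs → x ≈ -1# →
                             product xs ≈ -1#
  product-inverseClosed≈-1 {x} {xs} distinct closed x∈xs x≈-1 with ys , σ ← ∈⇒↭∷ x∈xs = begin
    product xs        ≡⟨ product-↭ σ ⟩
    x * product ys    ≈⟨ *-cong x≈-1 (product-inverseClosed≈1 ys distinct-ys closed-ys ys≉-1) ⟩
    -1# * 1           ≡⟨ *-identityʳ -1# ⟩
    -1#               ∎
    where
    open ≈-Reasoning
    distinct′ : AllPairs _≉_ (x ∷ ys)
    distinct′ = AllPairs-resp-↭ ≉-sym σ distinct
    distinct-ys : AllPairs _≉_ ys
    distinct-ys = AllPairs.tail distinct′
    xx≈1 : x * x ≈ 1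
    xx≈1 = ≈-trans (*-cong x≈-1 x≈-1) -1#*-1#≈1
    closed-ys : InverseClosed ys
    closed-ys = drop-self-inverse distinct′ (InverseClosed-resp-↭ σ closed) xx≈1
    ys≉-1 : All (_≉ -1#) ys
    ys≉-1 = All.map (λ x≉z z≈-1 → x≉z (≈-trans x≈-1 (≈-sym z≈-1))) (AllPairs.head distinct′)

  affine-injective : ∀ {c d i j} → c ≉ 0 → i < p → j < p → c * i + d ≈ c * j + d → i ≡ j
  affine-injective {d = d} c≉0 i<p j<p e = ≈⇒≡ i<p j<p (*-cancelˡ c≉0 (+-cancelʳ d e))

  affine-surjective : ∀ {c} d → c ≉ 0 → ∀ b → ∃[ k ] k < p × c * k + d ≈ b
  affine-surjective {c} d c≉0 b with t , ct≈1 ← inverse c≉0 = k , m%n<n _ p , (begin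
    c * k + d                     ≈⟨ +-congʳ d (*-congˡ c (%-≈ _)) ⟩
    c * ((b + -1# * d) * t) + d   ≡⟨ rearrange c (b + -1# * d) t d ⟩
    (b + -1# * d) * (c * t) + d   ≈⟨ +-congʳ d (*-congˡ (b + -1# * d) ct≈1) ⟩
    (b + -1# * d) * 1 + d         ≡⟨ collect b -1# d ⟩
    b + d * (1 + -1#)             ≡⟨ cong (λ m → b + d * m) 1+-1#≡n ⟩
    b + d * p                     ≈⟨ m+kn≈m b d ⟩
    b                             ∎)
    where
    open ≈-Reasoning
    k = (b + -1# * d) * t % p
    rearrange : ∀ c u t d → c * (u * t) + d ≡ u * (c * t) + d
    rearrange = solve-∀
    collect : ∀ b m d → (b + m * d) * 1 + d ≡ b + d * (1 + m)
    collect = solve-∀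

  module _ {c} (d : ℕ) (c≉0 : c ≉ 0) where

    private
      f : ℕ → ℕ
      f k = c * k + d

    product-nonzero-affine-values≈-1 : ∀ {z ws} → applyDownFrom f p ↭ z ∷ ws → z ≈ 0 →
                                       product ws ≈ -1#
    product-nonzero-affine-values≈-1 {z} {ws} σ z≈0 =
      let v , v∈ws , v≈-1 = value∈ws -1#≉0
      in  product-inverseClosed≈-1 (AllPairs.tail distinct-z∷ws) closed-ws v∈ws v≈-1
      where
      distinct : AllPairs _≉_ (applyDownFrom f p)
      distinct = applyDownFrom⁺₁ f p (λ j<i i<p f[i]≈f[j] →
        <-irrefl (≡.sym (affine-injective c≉0 i<p (<-trans j<i i<p) f[i]≈f[j])) j<i)
      distinct-z∷ws : AllPairs _≉_ (z ∷ ws)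
      distinct-z∷ws = AllPairs-resp-↭ ≉-sym σ distinct
      value∈ws : ∀ {b} → b ≉ 0 → ∃[ v ] v ∈ ws × v ≈ b
      value∈ws {b} b≉0 =
        let j , j<p , f[j]≈b = affine-surjective d c≉0 b
        in  pick (∈-resp-↭ σ (∈-applyDownFrom⁺ f j<p)) f[j]≈b
        where
        pick : ∀ {v} → v ∈ z ∷ ws → v ≈ b → ∃[ v ] v ∈ ws × v ≈ b
        pick (here refl)  z≈b = ⊥-elim (b≉0 (≈-trans (≈-sym z≈b) z≈0))
        pick (there v∈ws) v≈b = _ , v∈ws , v≈b
      closed-ws : InverseClosed ws
      closed-ws {w} w∈ws =
        let b , wb≈1 = inverse w≉0
            v , v∈ws , v≈b = value∈ws (λ b≈0 → 1≉0 (≈-trans (≈-sym wb≈1) (*≈0 w b≈0)))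
        in  v , v∈ws , ≈-trans (*-congˡ w v≈b) wb≈1
        where
        w≉0 : w ≉ 0
        w≉0 w≈0 = All.lookup (AllPairs.head distinct-z∷ws) w∈ws (≈-trans z≈0 (≈-sym w≈0))

    wilson-affine : ∀ {k₀} → k₀ < p → f k₀ ≈ 0 →
                    ∃[ w ] product (applyDownFrom f p) ≡ f k₀ * w × w ≈ -1#
    wilson-affine k₀<p f[k₀]≈0 with ws , σ ← ∈⇒↭∷ (∈-applyDownFrom⁺ f k₀<p) =
      product ws , product-↭ σ , product-nonzero-affine-values≈-1 σ f[k₀]≈0

3k+1 : ℕ → ℕ
3k+1 k = 3 * k + 1

!!!-step : ∀ m → (3 * suc m + 1) !!! ≡ (3 * suc m + 1) * (3 * m + 1) !!!
!!!-step m = begin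
  (3 * suc m + 1) !!!                   ≡⟨ cong _!!! (3[1+m]+1≡3+[3m+1] m) ⟩
  (3 + (3 * m + 1)) * (3 * m + 1) !!!   ≡⟨ cong (_* (3 * m + 1) !!!) (3[1+m]+1≡3+[3m+1] m) ⟨
  (3 * suc m + 1) * (3 * m + 1) !!!     ∎
  where
  open ≡.≡-Reasoning
  3[1+m]+1≡3+[3m+1] : ∀ m → 3 * suc m + 1 ≡ 3 + (3 * m + 1)
  3[1+m]+1≡3+[3m+1] = solve-∀

!!!≡product : ∀ m → (3 * m + 1) !!! ≡ product (applyDownFrom 3k+1 (suc m))
!!!≡product zero    = refl
!!!≡product (suc m) = ≡.trans (!!!-step m) (cong (3k+1 (suc m) *_) (!!!≡product m))

!!!-mono-∣ : ∀ {k m} → k ≤ m → (3 * k + 1) !!! ∣ (3 * m + 1) !!!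
!!!-mono-∣ {m = zero} z≤n = ∣-refl
!!!-mono-∣ {k} {suc m} k≤1+m with m≤n⇒m<n∨m≡n k≤1+m
... | inj₂ refl   = ∣-refl
... | inj₁ k<1+m  = ∣-trans (!!!-mono-∣ (≤-pred k<1+m))
  (≡.subst ((3 * m + 1) !!! ∣_) (≡.sym (!!!-step m)) (n∣m*n (3 * suc m + 1)))

4*[4+3r]∣!!! : ∀ {r m} → 1 ≤ r → r < m → 4 * (4 + 3 * r) ∣ (3 * m + 1) !!!
4*[4+3r]∣!!! {r} {m} 1≤r r<m = begin
  4 * (4 + 3 * r)                     ≡⟨ *-comm 4 (4 + 3 * r) ⟩
  (4 + 3 * r) * 4                     ∣⟨ *-monoʳ-∣ (4 + 3 * r) (!!!-mono-∣ 1≤r) ⟩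
  (4 + 3 * r) * (3 * r + 1) !!!       ≡⟨ cong (_* (3 * r + 1) !!!) (3[1+r]+1≡4+3r r) ⟨
  (3 * suc r + 1) * (3 * r + 1) !!!   ≡⟨ !!!-step r ⟨
  (3 * suc r + 1) !!!                 ∣⟨ !!!-mono-∣ r<m ⟩
  (3 * m + 1) !!!                     ∎
  where
  open ∣-Reasoning
  3[1+r]+1≡4+3r : ∀ r → 3 * suc r + 1 ≡ 4 + 3 * r
  3[1+r]+1≡4+3r = solve-∀

summand : ℕ → ℕ → ℕ
summand p r = 3 * r * (3 * p + 1) !!! / (2 * (4 + 3 * r))

summand-integral : ∀ {p r} → 1 ≤ r → r < p → summand p r * (2 * (4 + 3 * r)) ≡ 3 * r * (3 * p + 1) !!!
summand-integral {p} {r} 1≤r r<p = m/n*n≡m (begin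
  2 * (4 + 3 * r)              ∣⟨ *-monoˡ-∣ (4 + 3 * r) 2∣4 ⟩
  4 * (4 + 3 * r)              ∣⟨ 4*[4+3r]∣!!! 1≤r r<p ⟩
  (3 * p + 1) !!!              ∣⟨ n∣m*n (3 * r) ⟩
  3 * r * (3 * p + 1) !!!      ∎)
  where
  open ∣-Reasoning
  2∣4 : 2 ∣ 4
  2∣4 = divides 2 refl

n/1≡mkℚ : ∀ n → (+ n) ℚ./ 1 ≡ mkℚ (+ n) 0 (Coprime.sym (1-coprimeTo n))
n/1≡mkℚ n = normalize-coprime (Coprime.sym (1-coprimeTo n))

↥[n/1]≡n : ∀ n → ↥ ((+ n) ℚ./ 1) ≡ + n
↥[n/1]≡n n = cong ↥_ (n/1≡mkℚ n)

↧[n/1]≡1 : ∀ n → ↧ ((+ n) ℚ./ 1) ≡ + 1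
↧[n/1]≡1 n = cong ↧_ (n/1≡mkℚ n)

m/1+n/1≡[m+n]/1 : ∀ m n → (+ m) ℚ./ 1 ℚ.+ (+ n) ℚ./ 1 ≡ (+ (m + n)) ℚ./ 1
m/1+n/1≡[m+n]/1 m n rewrite n/1≡mkℚ m | n/1≡mkℚ n =
  /-cong (≡.trans (cong₂ ℤ._+_ (ℤ.*-identityʳ (+ m)) (ℤ.*-identityʳ (+ n))) (≡.sym (ℤ.pos-+ m n))) refl

[m*n]/n≡m/1 : ∀ m n → (+ (m * suc n)) ℚ./ suc n ≡ (+ m) ℚ./ 1
[m*n]/n≡m/1 m n = fromℚᵘ-cong {mkℚᵘ (+ (m * suc n)) n} {mkℚᵘ (+ m) 0}
  (*≡* (≡.trans (ℤ.*-identityʳ _) (ℤ.pos-* m (suc n))))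

sumℚ-map-/1 : ∀ (f : ℕ → ℕ) xs → sumℚ (map (λ x → (+ f x) ℚ./ 1) xs) ≡ (+ sum (map f xs)) ℚ./ 1
sumℚ-map-/1 f []       = refl
sumℚ-map-/1 f (x ∷ xs) =
  ≡.trans (cong ((+ f x) ℚ./ 1 ℚ.+_) (sumℚ-map-/1 f xs)) (m/1+n/1≡[m+n]/1 (f x) (sum (map f xs)))

term≡summand/1 : ∀ {p r} → 1 ≤ r → r < p → term p r ≡ (+ summand p r) ℚ./ 1
term≡summand/1 {p} {r} 1≤r r<p = ≡.trans
  (cong (λ m → (+ m) ℚ./ (2 * (4 + 3 * r))) (≡.sym (summand-integral 1≤r r<p)))
  ([m*n]/n≡m/1 (summand p r) _)

m<n∸1⇒1+m<n : ∀ n {i} → i < n ∸ 1 → suc i < n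
m<n∸1⇒1+m<n (suc n) i<n = s≤s i<n

α≡sum/1 : ∀ p → α p ≡ (+ sum (map (λ i → summand p (suc i)) (upTo (p ∸ 1)))) ℚ./ 1
α≡sum/1 p = ≡.trans
  (cong sumℚ (map-cong-local (All.tabulate λ i∈ →
    term≡summand/1 (s≤s z≤n) (m<n∸1⇒1+m<n p (∈-upTo⁻ i∈)))))
  (sumℚ-map-/1 (λ i → summand p (suc i)) (upTo (p ∸ 1)))

module _ {p : ℕ} (p-prime : Prime p) (3<p : 3 < p) where

  open PrimeModulus p-prime

  private
    4<p : 4 < p
    4<p with m≤n⇒m<n∨m≡n 3<p
    ... | inj₁ 4<p = 4<p
    ... | inj₂ refl = ⊥-elim (prime⇒¬composite p-prime composite[4])

    small≉0 : ∀ {a} → 0 < a → a ≤ 4 → a ≉ 0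
    small≉0 0<a a≤4 = positive<n⇒≉0 0<a (≤-<-trans a≤4 4<p)

    2≉0 : 2 ≉ 0
    2≉0 = small≉0 z<s (≤-trans (n≤1+n 2) (n≤1+n 3))

    3≉0 : 3 ≉ 0
    3≉0 = small≉0 z<s (n≤1+n 3)

    zero-of-3k+1 : ∃[ i₀ ] 2 + i₀ < p × 3k+1 (2 + i₀) ≈ 0
    zero-of-3k+1 = exclude-0-and-1 (affine-surjective 1 3≉0 0)
      where
      exclude-0-and-1 : ∃[ k ] k < p × 3k+1 k ≈ 0 → ∃[ i₀ ] 2 + i₀ < p × 3k+1 (2 + i₀) ≈ 0
      exclude-0-and-1 (0     , _    , 1≈0) = ⊥-elim (1≉0 1≈0)
      exclude-0-and-1 (1     , _    , 4≈0) = ⊥-elim (small≉0 z<s ≤-refl 4≈0)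
      exclude-0-and-1 (2+ i₀ , k₀<p , g≈0) = i₀ , k₀<p , g≈0

    -- 2 + i₀ is the root of 3k + 1; the summand that survives is the one with r = 1 + i₀.
    module _ {i₀ w} (k₀<p : 2 + i₀ < p) (g[k₀]≈0 : 3k+1 (2 + i₀) ≈ 0)
             (product≡g[k₀]*w : product (applyDownFrom 3k+1 p) ≡ 3k+1 (2 + i₀) * w) (w≈-1 : w ≈ -1#) where

      s : ℕ → ℕ
      s i = summand p (suc i)

      r₀<p : suc i₀ < p
      r₀<p = ≤-trans (n≤1+n _) k₀<p

      3[2+i]+1≡4+3[1+i] : ∀ i → 3 * (2 + i) + 1 ≡ 4 + 3 * suc i
      3[2+i]+1≡4+3[1+i] = solve-∀

      4+3[1+i₀]≈0 : 4 + 3 * suc i₀ ≈ 0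
      4+3[1+i₀]≈0 = ≈-trans (≡⇒≈ (≡.sym (3[2+i]+1≡4+3[1+i] i₀))) g[k₀]≈0

      [3p+1]!!!-split : (3 * p + 1) !!! ≡ 3k+1 p * ((4 + 3 * suc i₀) * w)
      [3p+1]!!!-split = ≡.trans (!!!≡product p)
        (cong (3k+1 p *_) (≡.trans product≡g[k₀]*w (cong (_* w) (3[2+i]+1≡4+3[1+i] i₀))))

      [3p+1]!!!≈0 : (3 * p + 1) !!! ≈ 0
      [3p+1]!!!≈0 = ≈-trans (≡⇒≈ [3p+1]!!!-split) (*≈0 (3k+1 p) (*-congʳ w 4+3[1+i₀]≈0))

      s≈0 : ∀ {i} → i ∈ upTo (p ∸ 1) → i ≢ i₀ → s i ≈ 0
      s≈0 {i} i∈ i≢i₀ =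
        fromInj₁ (⊥-elim ∘′ [ 2≉0 , 4+3[1+i]≉0 ]′ ∘′ *≈0⇒≈0⊎≈0) (*≈0⇒≈0⊎≈0 s[i]*2[4+3[1+i]]≈0)
        where
        open ≈-Reasoning
        r<p : suc i < p
        r<p = m<n∸1⇒1+m<n p (∈-upTo⁻ i∈)
        4+3[1+i]≉0 : 4 + 3 * suc i ≉ 0
        4+3[1+i]≉0 4+3[1+i]≈0 = i≢i₀ (suc-injective (affine-injective 3≉0 r<p r₀<p (begin
          3 * suc i + 4    ≡⟨ +-comm (3 * suc i) 4 ⟩
          4 + 3 * suc i    ≈⟨ 4+3[1+i]≈0 ⟩
          0                ≈⟨ 4+3[1+i₀]≈0 ⟨
          4 + 3 * suc i₀   ≡⟨ +-comm 4 (3 * suc i₀) ⟩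
          3 * suc i₀ + 4   ∎)))
        s[i]*2[4+3[1+i]]≈0 : s i * (2 * (4 + 3 * suc i)) ≈ 0
        s[i]*2[4+3[1+i]]≈0 =
          ≈-trans (≡⇒≈ (summand-integral (s≤s z≤n) r<p)) (*≈0 (3 * suc i) [3p+1]!!!≈0)

      s[i₀]*2≡3[1+i₀]*[3p+1]*w : s i₀ * 2 ≡ 3 * suc i₀ * 3k+1 p * w
      s[i₀]*2≡3[1+i₀]*[3p+1]*w = *-cancelʳ-≡ _ _ (4 + 3 * suc i₀) (begin
        s i₀ * 2 * (4 + 3 * suc i₀)                     ≡⟨ *-assoc (s i₀) 2 _ ⟩
        s i₀ * (2 * (4 + 3 * suc i₀))                   ≡⟨ summand-integral (s≤s z≤n) r₀<p ⟩
        3 * suc i₀ * (3 * p + 1) !!!                    ≡⟨ cong (3 * suc i₀ *_) [3p+1]!!!-split ⟩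
        3 * suc i₀ * (3k+1 p * ((4 + 3 * suc i₀) * w))  ≡⟨ regroup (3 * suc i₀) (3k+1 p) _ w ⟩
        3 * suc i₀ * 3k+1 p * w * (4 + 3 * suc i₀)      ∎)
        where
        open ≡.≡-Reasoning
        regroup : ∀ a b c w → a * (b * (c * w)) ≡ a * b * w * c
        regroup = solve-∀

      s[i₀]≈2 : s i₀ ≈ 2
      s[i₀]≈2 = *-cancelˡ 2≉0 (begin
        2 * s i₀                    ≡⟨ *-comm 2 (s i₀) ⟩
        s i₀ * 2                    ≡⟨ s[i₀]*2≡3[1+i₀]*[3p+1]*w ⟩
        3 * suc i₀ * 3k+1 p * w     ≈⟨ *-cong (*-congˡ (3 * suc i₀) 3p+1≈1) w≈-1 ⟩
        3 * suc i₀ * 1 * -1#        ≡⟨ cong (_* -1#) (*-identityʳ (3 * suc i₀)) ⟩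
        3 * suc i₀ * -1#            ≈⟨ x+y≈0⇒x≈y*-1# 4+3[1+i₀]≈0 ⟨
        2 * 2                       ∎)
        where
        open ≈-Reasoning
        3p+1≈1 : 3k+1 p ≈ 1
        3p+1≈1 = ≈-trans (≡⇒≈ (+-comm (3 * p) 1)) (m+kn≈m 1 3)

      sum-summands≈s[i₀] : sum (map s (upTo (p ∸ 1))) ≈ s i₀
      sum-summands≈s[i₀] = sum-≈-single s (upTo-unique (p ∸ 1)) (∈-upTo⁺ (∸-monoˡ-≤ 1 r₀<p)) s≈0

  sum-summands≈2 : sum (map (λ i → summand p (suc i)) (upTo (p ∸ 1))) ≈ 2
  sum-summands≈2 =
    let _ , k₀<p , g[k₀]≈0    = zero-of-3k+1
        _ , product≡ , w≈-1   = wilson-affine 1 3≉0 k₀<p g[k₀]≈0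
    in  ≈-trans (sum-summands≈s[i₀] k₀<p g[k₀]≈0 product≡ w≈-1)
                (s[i₀]≈2 k₀<p g[k₀]≈0 product≡ w≈-1)

p∤↧[n/1] : ∀ {p} n → 1 < p → ¬ (+ p ℤ.∣ ↧ ((+ n) ℚ./ 1))
p∤↧[n/1] {p} n 1<p p∣↧ = <-irrefl (≡.sym (∣1⇒≡1 (≡.subst (+ p ℤ.∣_) (↧[n/1]≡1 n) p∣↧))) 1<p

p∣↥-b*↧[n/1] : ∀ {p} b n → ∃[ k ] n ≡ b + k * p →
               + p ℤ.∣ ↥ ((+ n) ℚ./ 1) ℤ.- + b ℤ.* ↧ ((+ n) ℚ./ 1)
p∣↥-b*↧[n/1] {p} b n (k , n≡b+kp) = ≡.subst (+ p ℤ.∣_) (≡.sym ↥-b*↧≡kp) (n∣m*n k)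
  where
  open ≡.≡-Reasoning
  cancel : ∀ x y → x ℤ.+ y ℤ.- x ≡ y
  cancel = ℤ-Solver.solve-∀
  ↥-b*↧≡kp : ↥ ((+ n) ℚ./ 1) ℤ.- + b ℤ.* ↧ ((+ n) ℚ./ 1) ≡ + (k * p)
  ↥-b*↧≡kp = begin
    ↥ ((+ n) ℚ./ 1) ℤ.- + b ℤ.* ↧ ((+ n) ℚ./ 1)
      ≡⟨ cong₂ (λ x y → x ℤ.- + b ℤ.* y) (↥[n/1]≡n n) (↧[n/1]≡1 n) ⟩
    + n ℤ.- + b ℤ.* + 1                          ≡⟨ cong₂ ℤ._-_ (cong +_ n≡b+kp) (ℤ.*-identityʳ (+ b)) ⟩
    + (b + k * p) ℤ.- + b                        ≡⟨ cong (ℤ._- + b) (ℤ.pos-+ b (k * p)) ⟩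
    + b ℤ.+ + (k * p) ℤ.- + b                    ≡⟨ cancel (+ b) (+ (k * p)) ⟩
    + (k * p)                                    ∎

proposition1 : (p : ℕ) → Prime p → p > 3 →
    (¬ ((+ p) ℤ.∣ (↧ (α p)))) × ((+ p) ℤ.∣ ((↥ (α p)) ℤ.- (+ 2) ℤ.* (↧ (α p))))
proposition1 p p-prime 3<p =
  ≡.subst (λ q → ¬ (+ p ℤ.∣ ↧ q) × + p ℤ.∣ ↥ q ℤ.- + 2 ℤ.* ↧ q) (≡.sym (α≡sum/1 p))
    ( p∤↧[n/1] M (≤-trans (s≤s (s≤s z≤n)) 3<p)
    , p∣↥-b*↧[n/1] 2 M (≈⇒≡+kn (<⇒≤ 3<p) (sum-summands≈2 p-prime 3<p)))
  where
  open PrimeModulus p-prime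
  M : ℕ
  M = sum (map (λ i → summand p (suc i)) (upTo (p ∸ 1)))
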